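{- Let $\Sigma$ be an arbitrary signed graph and let $G,H$ be two non-isomorphic cospectrally rooted graphs with roots $u,v$ respectively. Then the signed graphs $\Sigma[G^+]$ and $\Sigma[H^+]$ are cospectral.
   Context: A signed graph $\Sigma=(G,\sigma)$ is a simple graph $G$ with a sign function $\sigma:E(G)\to\{+1,-1\}$; its adjacency matrix has $(i,j)$ entry $\sigma(v_iv_j)$ if $v_i\sim v_j$ and $0$ otherwise. Two (signed) graphs are cospectral if their adjacency matrices have the same spectrum (multiset of eigenvalues). Two rooted graphs $G,H$ with roots $u,v$ are cospectrally rooted if $G$ and $H$ are cospectral and $G-u$ and $H-v$ are cospectral. $G^+$ denotes the signed graph on $G$ with all edges positive, rooted at the root of $G$. For a signed graph $\Sigma$ with vertices $v_1,\ldots,v_n$ and a rooted signed graph $\Pi$, the rooted product $\Sigma[\Pi]$ is obtained by taking $\Sigma$ and $n$ disjoint copies of $\Pi$ and identifying each $v_i$ with the root of the $i$-th copy, all edges keeping their signs. -}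

module Defs where

open import Data.Nat using (ℕ; zero; suc; _*_)
open import Data.Fin using (Fin; zero; suc; punchIn; combine; _≟_)
open import Data.Integer using (ℤ; _+_; _-_; -_; 0ℤ; 1ℤ; -1ℤ)
open import Data.Bool using (Bool; true; false; if_then_else_)
open import Data.Product using (Σ; _×_; _,_)
open import Data.Sum using (_⊎_)
open import Relation.Binary.PropositionalEquality using (_≡_)
open import Relation.Nullary.Decidable using (⌊_⌋)
open import Function.Definitions using (Bijective)

Matrix : ℕ → Set
Matrix n = Fin n → Fin n → ℤ

sumFin : ∀ {n} → (Fin n → ℤ) → ℤ
sumFin {zero}  f = 0ℤ
sumFin {suc n} f = f zero + sumFin (λ i → f (suc i))

altSum : ∀ {n} → (Fin n → ℤ) → ℤ
altSum {zero}  f = 0ℤ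
altSum {suc n} f = f zero - altSum (λ i → f (suc i))

det : ∀ {n} → Matrix n → ℤ
det {zero}  A = 1ℤ
det {suc n} A = altSum (λ j → A zero j Data.Integer.* det (λ a b → A (suc a) (punchIn j b)))

charPoly : ∀ {n} → Matrix n → ℤ → ℤ
charPoly A x = det (λ i j → (if ⌊ i ≟ j ⌋ then x else 0ℤ) - A i j)

-- cospectral matrices: equal characteristic polynomials
-- (two integer polynomials are equal iff they agree on all of ℤ)
Cospectral : ∀ {n} → Matrix n → Matrix n → Set
Cospectral A B = ∀ x → charPoly A x ≡ charPoly B x

record SimpleGraph (n : ℕ) : Set where
  field
    adj    : Fin n → Fin n → Bool
    sym    : ∀ i j → adj i j ≡ adj j i
    irrefl : ∀ i → adj i i ≡ false
open SimpleGraph public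

IsSignEntry : ℤ → Set
IsSignEntry z = (z ≡ 1ℤ ⊎ z ≡ -1ℤ) ⊎ z ≡ 0ℤ

record SignedGraph (n : ℕ) : Set where
  field
    mat    : Matrix n
    sym    : ∀ i j → mat i j ≡ mat j i
    zeroDiag : ∀ i → mat i i ≡ 0ℤ
    entries  : ∀ i j → IsSignEntry (mat i j)
open SignedGraph public

-- adjacency matrix of a simple graph (= adjacency matrix of G^+)
adjMat : ∀ {n} → SimpleGraph n → Matrix n
adjMat G i j = if adj G i j then 1ℤ else 0ℤ

deleteMat : ∀ {k} → Matrix (suc k) → Fin (suc k) → Matrix k
deleteMat A u a b = A (punchIn u a) (punchIn u b)

Isomorphic : ∀ {n} → SimpleGraph n → SimpleGraph n → Set
Isomorphic {n} G H = Σ (Fin n → Fin n) λ π →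
  Bijective _≡_ _≡_ π × (∀ i j → adj H (π i) (π j) ≡ adj G i j)

CospectrallyRooted : ∀ {k} → SimpleGraph (suc k) → Fin (suc k)
                           → SimpleGraph (suc k) → Fin (suc k) → Set
CospectrallyRooted G u H v =
  Cospectral (adjMat G) (adjMat H) ×
  Cospectral (deleteMat (adjMat G) u) (deleteMat (adjMat H) v)

-- Vertex (i , j) (copy i,
-- vertex j of Π) is encoded as combine i j : Fin (n * m); the vertex
-- (i , r) is identified with v_i of Σ.
rootedProductMat : ∀ {n m} → Matrix n → Matrix m → Fin m → Matrix (n * m)
rootedProductMat {n} {m} S P r = λ x y → entry (Data.Fin.remQuot {n} m x) (Data.Fin.remQuot {n} m y)
  where
  entry : Fin n × Fin m → Fin n × Fin m → ℤ
  entry (i , j) (i' , j') =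
    (if ⌊ i ≟ i' ⌋ then P j j' else 0ℤ) +
    (if ⌊ j ≟ r ⌋ then (if ⌊ j' ≟ r ⌋ then S i i' else 0ℤ) else 0ℤ)

{-# OPTIONS --safe #-}
-- Write φ_P for det (x I − P). In the characteristic matrix of Σ[P] the root of a
-- copy of P is a cut vertex, separating the rest of that copy from everything else.
-- Splitting the root's row into its two sides and using block triangularity gives
--   det = φ_P · det (copy and root removed) + φ_{P−r} · det (copy removed, root kept bare),
-- where a bare vertex carries no x on the diagonal. Iterating over the copies, for
-- rooted products in which some base vertices are bare, shows that the
-- characteristic polynomial of Σ[P] depends on P only through φ_P and φ_{P−r};
-- these agree for cospectrally rooted G and H.
module Submission where

open import Defs hiding (sym)
open import Data.Nat using (ℕ; zero; suc) renaming (_+_ to _+ℕ_; _*_ to _*ℕ_)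
open import Data.Fin using (Fin; zero; suc; punchIn; punchOut; _↑ˡ_; _↑ʳ_; splitAt; join; _≟_)
open import Data.Fin.Properties using (suc-injective; punchInᵢ≢i; punchIn-injective; punchOut-punchIn; punchOut-cong; splitAt-↑ˡ; splitAt-↑ʳ; join-splitAt; +↔⊎; *↔×)
open import Data.Fin.Permutation using (Permutation; Permutation′; permutation; _⟨$⟩ʳ_; _⟨$⟩ˡ_; inverseˡ; inverseʳ; insert; remove; lift₀; punchIn-permute; ↔⇒≡) renaming (id to idₚ)
open import Data.Sum as Sum using (_⊎_; inj₁; inj₂; [_,_]′)
open import Data.Product using (_×_; _,_)
import Data.Sum.Properties as SumP
import Data.Product.Properties as ProdP
open import Data.Sum.Algebra using (⊎-cong)
open import Data.Bool using (true; false; if_then_else_)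
open import Function.Bundles using (_↔_; Inverse)
open import Function.Construct.Composition using (_↔-∘_)
open import Function.Construct.Identity using (↔-id)
open import Data.Integer using (ℤ; _+_; _-_; -_; _*_; 0ℤ; 1ℤ)
open import Data.Integer.Properties using (+-*-semiring; neg-distrib-+; neg-involutive; neg-distribˡ-*; *-assoc; *-identityˡ; *-zeroʳ; +-assoc; +-identityˡ; +-identityʳ)
open import Data.Integer.Solver using (module +-*-Solver)
open import Algebra.Properties.Semiring.Sum +-*-semiring using (sum; sum-syntax; sum-cong-≗; ∑-comm; ∑-distrib-+; *-distribˡ-sum; *-distribʳ-sum; sum-remove; sum-replicate-zero)
open import Relation.Nullary using (¬_; yes; no)
open import Relation.Nullary.Decidable using (⌊_⌋)
open import Relation.Binary.Definitions using (DecidableEquality)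
open import Data.Empty using (⊥-elim)
open import Relation.Binary.PropositionalEquality using (_≡_; _≢_; refl; sym; trans; cong; cong₂; subst; module ≡-Reasoning)

open +-*-Solver using (solve; _:+_; _:*_; :-_; _:-_; _:=_; con)

sign : ∀ {n} → Fin n → ℤ
sign zero    = 1ℤ
sign (suc i) = - sign i

sign*sign≡1 : ∀ {n} (i : Fin n) → sign i * sign i ≡ 1ℤ
sign*sign≡1 zero    = refl
sign*sign≡1 (suc i) = trans (solve 1 (λ s → (:- s) :* (:- s) := s :* s) refl (sign i)) (sign*sign≡1 i)

neg-sum : ∀ {n} (f : Fin n → ℤ) → - sum f ≡ sum (λ i → - f i)
neg-sum {zero}  f = refl
neg-sum {suc n} f = trans (neg-distrib-+ (f zero) _) (cong (- f zero +_) (neg-sum (λ i → f (suc i))))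

altSum≡∑ : ∀ {n} (f : Fin n → ℤ) → altSum f ≡ ∑[ j < n ] (sign j * f j)
altSum≡∑ {zero}  f = refl
altSum≡∑ {suc n} f = cong₂ _+_ (sym (*-identityˡ (f zero))) (begin
  - altSum (λ j → f (suc j))                  ≡⟨ cong -_ (altSum≡∑ (λ j → f (suc j))) ⟩
  - ∑[ j < n ] (sign j * f (suc j))           ≡⟨ neg-sum (λ j → sign j * f (suc j)) ⟩
  ∑[ j < n ] (- (sign j * f (suc j)))         ≡⟨ sum-cong-≗ (λ j → solve 2 (λ s a → :- (s :* a) := (:- s) :* a) refl (sign j) (f (suc j))) ⟩
  ∑[ j < n ] (sign (suc j) * f (suc j))       ∎)
  where open ≡-Reasoning

∑-distribˡ₂ : ∀ {n} x y (f : Fin n → ℤ) → x * (y * ∑[ i < n ] f i) ≡ ∑[ i < n ] (x * (y * f i))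
∑-distribˡ₂ x y f = trans (cong (x *_) (*-distribˡ-sum y f)) (*-distribˡ-sum x (λ i → y * f i))

sum-↑ : ∀ k {a} (f : Fin (k +ℕ a) → ℤ) → sum f ≡ ∑[ i < k ] f (i ↑ˡ a) + ∑[ l < a ] f (k ↑ʳ l)
sum-↑ zero    f = sym (+-identityˡ (sum f))
sum-↑ (suc k) f = trans (cong (f zero +_) (sum-↑ k (λ x → f (suc x)))) (sym (+-assoc (f zero) _ _))

sum-punchIn : ∀ {n} (f : Fin (suc n) → ℤ) i → f i ≡ 0ℤ → sum f ≡ ∑[ k < n ] f (punchIn i k)
sum-punchIn f i fᵢ≡0 = trans (sum-remove {i = i} f) (trans (cong (_+ ∑[ k < _ ] f (punchIn i k)) fᵢ≡0) (+-identityˡ _))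

sum-zero : ∀ {n} (f : Fin n → ℤ) → (∀ i → f i ≡ 0ℤ) → sum f ≡ 0ℤ
sum-zero {n} f f≗0 = trans (sum-cong-≗ f≗0) (sum-replicate-zero n)

-- Laplace expansion and transposition

minor : ∀ {n} → Matrix (suc n) → Fin (suc n) → Matrix n
minor A j a b = A (suc a) (punchIn j b)

colMinor : ∀ {n} → Matrix (suc n) → Fin (suc n) → Matrix n
colMinor A i a b = A (punchIn i a) (suc b)

transpose : ∀ {n} → Matrix n → Matrix n
transpose A i j = A j i

det-laplace : ∀ {n} (A : Matrix (suc n)) →
  det A ≡ ∑[ j < suc n ] (sign j * (A zero j * det (minor A j)))
det-laplace A = altSum≡∑ (λ j → A zero j * det (minor A j))

det-cong : ∀ {n} {A B : Matrix n} → (∀ i j → A i j ≡ B i j) → det A ≡ det B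
det-cong {zero}          A≗B = refl
det-cong {suc n} {A} {B} A≗B = begin
  det A                                                    ≡⟨ det-laplace A ⟩
  ∑[ j < suc n ] (sign j * (A zero j * det (minor A j)))
    ≡⟨ sum-cong-≗ (λ j → cong₂ (λ a d → sign j * (a * d)) (A≗B zero j) (det-cong (λ a b → A≗B (suc a) (punchIn j b)))) ⟩
  ∑[ j < suc n ] (sign j * (B zero j * det (minor B j)))   ≡⟨ sym (det-laplace B) ⟩
  det B                                                    ∎
  where open ≡-Reasoning

det-scaleMinors : ∀ {n} (A B : Matrix (suc n)) c → (∀ j → A zero j ≡ B zero j) →
  (∀ j → det (minor A j) ≡ c * det (minor B j)) → det A ≡ c * det B
det-scaleMinors {n} A B c A₀≡B₀ minorA≡c*minorB = begin
  det A                                                           ≡⟨ det-laplace A ⟩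
  ∑[ j < suc n ] (sign j * (A zero j * det (minor A j)))
    ≡⟨ sum-cong-≗ (λ j → cong₂ (λ e d → sign j * (e * d)) (A₀≡B₀ j) (minorA≡c*minorB j)) ⟩
  ∑[ j < suc n ] (sign j * (B zero j * (c * det (minor B j))))
    ≡⟨ sum-cong-≗ (λ j → pull (sign j) (B zero j) c (det (minor B j))) ⟩
  ∑[ j < suc n ] (c * (sign j * (B zero j * det (minor B j))))
    ≡⟨ sym (*-distribˡ-sum c (λ j → sign j * (B zero j * det (minor B j)))) ⟩
  c * ∑[ j < suc n ] (sign j * (B zero j * det (minor B j)))      ≡⟨ cong (c *_) (sym (det-laplace B)) ⟩
  c * det B                                                       ∎
  where
  open ≡-Reasoning
  pull : ∀ s e c d → s * (e * (c * d)) ≡ c * (s * (e * d))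
  pull = solve 4 (λ s e c d → s :* (e :* (c :* d)) := c :* (s :* (e :* d))) refl

-- Expanding once more, both sides become the same double sum over the minors
-- with rows {0, i} and columns {0, j} deleted.
det-laplace-col₀ : ∀ {n} (A : Matrix (suc n)) →
  det A ≡ ∑[ i < suc n ] (sign i * (A i zero * det (colMinor A i)))
det-laplace-col₀ {zero}  A = det-laplace A
det-laplace-col₀ {suc n} A = trans (det-laplace A) (cong (1ℤ * (A zero zero * det (minor A zero)) +_) (begin
  ∑[ j < suc n ] (- sign j * (A zero (suc j) * det (minor A (suc j))))
    ≡⟨ sum-cong-≗ (λ j → cong (λ d → - sign j * (A zero (suc j) * d)) (det-laplace-col₀ (minor A (suc j)))) ⟩
  ∑[ j < suc n ] (- sign j * (A zero (suc j) * ∑[ i < suc n ] (sign i * (A (suc i) zero * D i j))))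
    ≡⟨ sum-cong-≗ (λ j → ∑-distribˡ₂ (- sign j) (A zero (suc j)) (λ i → sign i * (A (suc i) zero * D i j))) ⟩
  ∑[ j < suc n ] ∑[ i < suc n ] (- sign j * (A zero (suc j) * (sign i * (A (suc i) zero * D i j))))
    ≡⟨ ∑-comm (λ j i → - sign j * (A zero (suc j) * (sign i * (A (suc i) zero * D i j)))) ⟩
  ∑[ i < suc n ] ∑[ j < suc n ] (- sign j * (A zero (suc j) * (sign i * (A (suc i) zero * D i j))))
    ≡⟨ sum-cong-≗ (λ i → sum-cong-≗ (λ j → swapSigns (sign j) (A zero (suc j)) (sign i) (A (suc i) zero) (D i j))) ⟩
  ∑[ i < suc n ] ∑[ j < suc n ] (- sign i * (A (suc i) zero * (sign j * (A zero (suc j) * D i j))))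
    ≡⟨ sum-cong-≗ (λ i → sym (∑-distribˡ₂ (- sign i) (A (suc i) zero) (λ j → sign j * (A zero (suc j) * D i j)))) ⟩
  ∑[ i < suc n ] (- sign i * (A (suc i) zero * ∑[ j < suc n ] (sign j * (A zero (suc j) * D i j))))
    ≡⟨ sum-cong-≗ (λ i → cong (λ d → - sign i * (A (suc i) zero * d)) (sym (det-laplace (colMinor A (suc i))))) ⟩
  ∑[ i < suc n ] (- sign i * (A (suc i) zero * det (colMinor A (suc i))))   ∎))
  where
  open ≡-Reasoning
  D : Fin (suc n) → Fin (suc n) → ℤ
  D i j = det (λ a b → A (suc (punchIn i a)) (suc (punchIn j b)))
  swapSigns : ∀ s a t b d → - s * (a * (t * (b * d))) ≡ - t * (b * (s * (a * d)))
  swapSigns = solve 5 (λ s a t b d → (:- s) :* (a :* (t :* (b :* d))) := (:- t) :* (b :* (s :* (a :* d)))) refl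

det-transpose : ∀ {n} (A : Matrix n) → det (transpose A) ≡ det A
det-transpose {zero}  A = refl
det-transpose {suc n} A = begin
  det (transpose A)                                               ≡⟨ det-laplace (transpose A) ⟩
  ∑[ i < suc n ] (sign i * (A i zero * det (transpose (colMinor A i))))
    ≡⟨ sum-cong-≗ (λ i → cong (λ d → sign i * (A i zero * d)) (det-transpose (colMinor A i))) ⟩
  ∑[ i < suc n ] (sign i * (A i zero * det (colMinor A i)))       ≡⟨ sym (det-laplace-col₀ A) ⟩
  det A                                                           ∎
  where open ≡-Reasoning

-- Permuting rows and columns

punchIn-punchOut-comm : ∀ {n} {j b : Fin (suc (suc n))} (j≢b : j ≢ b) (b≢j : b ≢ j) (c : Fin n) →
  punchIn j (punchIn (punchOut j≢b) c) ≡ punchIn b (punchIn (punchOut b≢j) c)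
punchIn-punchOut-comm {j = zero}  {zero}  j≢b _ c = ⊥-elim (j≢b refl)
punchIn-punchOut-comm {j = zero}  {suc b} _   _ c = refl
punchIn-punchOut-comm {j = suc j} {zero}  _   _ c = refl
punchIn-punchOut-comm {suc n} {suc j} {suc b} _ _ zero = refl
punchIn-punchOut-comm {suc n} {suc j} {suc b} j≢b b≢j (suc c) =
  cong suc (punchIn-punchOut-comm (λ e → j≢b (cong suc e)) (λ e → b≢j (cong suc e)) c)

sign-punchOut-antisym : ∀ {n} {j b : Fin (suc n)} (j≢b : j ≢ b) (b≢j : b ≢ j) →
  sign b * sign (punchOut b≢j) ≡ - (sign j * sign (punchOut j≢b))
sign-punchOut-antisym {j = zero}  {zero}  j≢b _ = ⊥-elim (j≢b refl)
sign-punchOut-antisym {suc n} {zero}  {suc b} _ _ = solve 1 (λ s → (:- s) :* con 1ℤ := :- (con 1ℤ :* s)) refl (sign b)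
sign-punchOut-antisym {suc n} {suc j} {zero} _ _ = solve 1 (λ s → con 1ℤ :* s := :- ((:- s) :* con 1ℤ)) refl (sign j)
sign-punchOut-antisym {suc n} {suc j} {suc b} j≢b b≢j = begin
  - sign b * - sign (punchOut b≢j′)    ≡⟨ negate² (sign b) _ ⟩
  sign b * sign (punchOut b≢j′)        ≡⟨ sign-punchOut-antisym j≢b′ b≢j′ ⟩
  - (sign j * sign (punchOut j≢b′))    ≡⟨ cong -_ (sym (negate² (sign j) _)) ⟩
  - (- sign j * - sign (punchOut j≢b′)) ∎
  where
  open ≡-Reasoning
  j≢b′ : j ≢ b
  j≢b′ e = j≢b (cong suc e)
  b≢j′ : b ≢ j
  b≢j′ e = b≢j (cong suc e)
  negate² : ∀ x y → - x * - y ≡ x * y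
  negate² = solve 2 (λ x y → (:- x) :* (:- y) := x :* y) refl

swapRows₀₁ : ∀ {n} → Matrix (suc (suc n)) → Matrix (suc (suc n))
swapRows₀₁ A zero          = A (suc zero)
swapRows₀₁ A (suc zero)    = A zero
swapRows₀₁ A (suc (suc i)) = A (suc (suc i))

module TwoRowExpansion {n : ℕ} (rest : Fin n → Fin (suc (suc n)) → ℤ) where

  D : Fin (suc (suc n)) → Fin (suc n) → ℤ
  D j k = det (λ a c → rest a (punchIn j (punchIn k c)))

  -- For the matrix with rows u, v and then rest: the part of its determinant
  -- that uses column j in row 0 and column b in row 1.
  term : (u v : Fin (suc (suc n)) → ℤ) → Fin (suc (suc n)) → Fin (suc (suc n)) → ℤ
  term u v j b with j ≟ b
  ... | yes _  = 0ℤ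
  ... | no j≢b = sign j * sign (punchOut j≢b) * (u j * v b * D j (punchOut j≢b))

  term-diag : ∀ u v j → term u v j j ≡ 0ℤ
  term-diag u v j with j ≟ j
  ... | yes _  = refl
  ... | no j≢j = ⊥-elim (j≢j refl)

  term-punchIn : ∀ u v j k → term u v j (punchIn j k) ≡ sign j * sign k * (u j * v (punchIn j k) * D j k)
  term-punchIn u v j k with j ≟ punchIn j k
  ... | yes j≡jₖ = ⊥-elim (punchInᵢ≢i j k (sym j≡jₖ))
  ... | no j≢jₖ  = cong (λ k′ → sign j * sign k′ * (u j * v (punchIn j k) * D j k′))
                        (trans (punchOut-cong j refl) (punchOut-punchIn j))

  term-antisym : ∀ u v j b → term v u j b ≡ - term u v b j
  term-antisym u v j b with j ≟ b | b ≟ j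
  ... | yes _   | yes _   = refl
  ... | yes j≡b | no b≢j  = ⊥-elim (b≢j (sym j≡b))
  ... | no j≢b  | yes b≡j = ⊥-elim (j≢b (sym b≡j))
  ... | no j≢b  | no b≢j  = begin
    sign j * sign (punchOut j≢b) * (v j * u b * D j (punchOut j≢b))
      ≡⟨ cong (λ d → sign j * sign (punchOut j≢b) * (v j * u b * d))
              (det-cong (λ a c → cong (rest a) (punchIn-punchOut-comm j≢b b≢j c))) ⟩
    sign j * sign (punchOut j≢b) * (v j * u b * D b (punchOut b≢j))
      ≡⟨ flip (sign j * sign (punchOut j≢b)) (v j) (u b) (D b (punchOut b≢j)) ⟩
    - (- (sign j * sign (punchOut j≢b)) * (u b * v j * D b (punchOut b≢j)))
      ≡⟨ cong (λ s → - (s * (u b * v j * D b (punchOut b≢j)))) (sym (sign-punchOut-antisym j≢b b≢j)) ⟩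
    - (sign b * sign (punchOut b≢j) * (u b * v j * D b (punchOut b≢j))) ∎
    where
    open ≡-Reasoning
    flip : ∀ s x y d → s * (x * y * d) ≡ - (- s * (y * x * d))
    flip = solve 4 (λ s x y d → s :* (x :* y :* d) := :- ((:- s) :* (y :* x :* d))) refl

det-twoRows : ∀ {n} (A : Matrix (suc (suc n))) → let open TwoRowExpansion (λ a → A (suc (suc a))) in
  det A ≡ ∑[ j < suc (suc n) ] ∑[ b < suc (suc n) ] term (A zero) (A (suc zero)) j b
det-twoRows {n} A = trans (det-laplace A) (sum-cong-≗ λ j → begin
  sign j * (A zero j * det (minor A j))
    ≡⟨ cong (λ d → sign j * (A zero j * d)) (det-laplace (minor A j)) ⟩
  sign j * (A zero j * ∑[ k < suc n ] (sign k * (A (suc zero) (punchIn j k) * D j k)))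
    ≡⟨ ∑-distribˡ₂ (sign j) (A zero j) (λ k → sign k * (A (suc zero) (punchIn j k) * D j k)) ⟩
  ∑[ k < suc n ] (sign j * (A zero j * (sign k * (A (suc zero) (punchIn j k) * D j k))))
    ≡⟨ sum-cong-≗ (λ k → trans (regroup (sign j) (A zero j) (sign k) _ _) (sym (term-punchIn (A zero) (A (suc zero)) j k))) ⟩
  ∑[ k < suc n ] term (A zero) (A (suc zero)) j (punchIn j k)
    ≡⟨ sym (sum-punchIn (term (A zero) (A (suc zero)) j) j (term-diag (A zero) (A (suc zero)) j)) ⟩
  ∑[ b < suc (suc n) ] term (A zero) (A (suc zero)) j b ∎)
  where
  open ≡-Reasoning
  open TwoRowExpansion (λ a → A (suc (suc a)))
  regroup : ∀ s a t b d → s * (a * (t * (b * d))) ≡ s * t * (a * b * d)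
  regroup = solve 5 (λ s a t b d → s :* (a :* (t :* (b :* d))) := s :* t :* (a :* b :* d)) refl

det-swapRows₀₁ : ∀ {n} (A : Matrix (suc (suc n))) → det (swapRows₀₁ A) ≡ - det A
det-swapRows₀₁ {n} A = begin
  det (swapRows₀₁ A)                               ≡⟨ det-twoRows (swapRows₀₁ A) ⟩
  ∑[ j < suc (suc n) ] ∑[ b < suc (suc n) ] term (A (suc zero)) (A zero) j b
    ≡⟨ sum-cong-≗ (λ j → sum-cong-≗ (λ b → term-antisym (A zero) (A (suc zero)) j b)) ⟩
  ∑[ j < suc (suc n) ] ∑[ b < suc (suc n) ] (- term (A zero) (A (suc zero)) b j)
    ≡⟨ ∑-comm (λ j b → - term (A zero) (A (suc zero)) b j) ⟩
  ∑[ b < suc (suc n) ] ∑[ j < suc (suc n) ] (- term (A zero) (A (suc zero)) b j)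
    ≡⟨ sum-cong-≗ (λ b → sym (neg-sum (term (A zero) (A (suc zero)) b))) ⟩
  ∑[ b < suc (suc n) ] (- ∑[ j < suc (suc n) ] term (A zero) (A (suc zero)) b j)
    ≡⟨ sym (neg-sum (λ b → ∑[ j < suc (suc n) ] term (A zero) (A (suc zero)) b j)) ⟩
  - ∑[ b < suc (suc n) ] ∑[ j < suc (suc n) ] term (A zero) (A (suc zero)) b j
    ≡⟨ cong -_ (sym (det-twoRows A)) ⟩
  - det A ∎
  where
  open ≡-Reasoning
  open TwoRowExpansion (λ a → A (suc (suc a)))

rotate : ∀ {n} → Fin (suc n) → Fin (suc n) → Fin (suc n)
rotate p zero    = p
rotate p (suc i) = punchIn p i

det-rotateRows : ∀ {n} (p : Fin (suc n)) (A : Matrix (suc n)) → det (λ i → A (rotate p i)) ≡ sign p * det A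
det-rotateRows zero A = trans (det-cong rotate-zero) (sym (*-identityˡ (det A)))
  where
  rotate-zero : ∀ i j → A (rotate zero i) j ≡ A i j
  rotate-zero zero    j = refl
  rotate-zero (suc i) j = refl
det-rotateRows {suc n} (suc p) A = begin
  det B                         ≡⟨ sym (neg-involutive (det B)) ⟩
  - - det B                     ≡⟨ cong -_ (sym (det-swapRows₀₁ B)) ⟩
  - det (swapRows₀₁ B)          ≡⟨ cong -_ (det-scaleMinors (swapRows₀₁ B) A (sign p) (λ _ → refl)
                                     (λ j → trans (det-cong (minor-swapRows₀₁ j)) (det-rotateRows p (minor A j)))) ⟩
  - (sign p * det A)            ≡⟨ neg-distribˡ-* (sign p) (det A) ⟩
  - sign p * det A              ∎
  where
  open ≡-Reasoning
  B : Matrix (suc (suc n))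
  B i = A (rotate (suc p) i)
  minor-swapRows₀₁ : ∀ j a b → minor (swapRows₀₁ B) j a b ≡ minor A j (rotate p a) b
  minor-swapRows₀₁ j zero    b = refl
  minor-swapRows₀₁ j (suc a) b = refl

permSign : ∀ {n} → Permutation′ n → ℤ
permSign {zero}  π = 1ℤ
permSign {suc n} π = sign (π ⟨$⟩ʳ zero) * permSign (remove zero π)

permSign*permSign≡1 : ∀ {n} (π : Permutation′ n) → permSign π * permSign π ≡ 1ℤ
permSign*permSign≡1 {zero}  π = refl
permSign*permSign≡1 {suc n} π = begin
  s * e * (s * e)     ≡⟨ solve 2 (λ s e → s :* e :* (s :* e) := s :* s :* (e :* e)) refl s e ⟩
  s * s * (e * e)     ≡⟨ cong₂ _*_ (sign*sign≡1 (π ⟨$⟩ʳ zero)) (permSign*permSign≡1 (remove zero π)) ⟩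
  1ℤ                  ∎
  where
  open ≡-Reasoning
  s e : ℤ
  s = sign (π ⟨$⟩ʳ zero)
  e = permSign (remove zero π)

-- Writing π = rotate (π 0) ∘ lift₀ (remove 0 π), the rotation is paid for by
-- det-rotateRows and the lifted permutation by induction in the minors.
det-permuteRows : ∀ {n} (π : Permutation′ n) (A : Matrix n) → det (λ i → A (π ⟨$⟩ʳ i)) ≡ permSign π * det A
det-permuteRows {zero}  π A = refl
det-permuteRows {suc n} π A = begin
  det (λ i → A (π ⟨$⟩ʳ i))          ≡⟨ det-cong (λ i j → cong (λ k → A k j) (decompose i)) ⟩
  det (λ i → B (lift₀ π′ ⟨$⟩ʳ i))   ≡⟨ det-scaleMinors (λ i → B (lift₀ π′ ⟨$⟩ʳ i)) B (permSign π′) (λ _ → refl)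
                                         (λ j → det-permuteRows π′ (minor B j)) ⟩
  permSign π′ * det B               ≡⟨ cong (permSign π′ *_) (det-rotateRows p A) ⟩
  permSign π′ * (sign p * det A)    ≡⟨ solve 3 (λ e s d → e :* (s :* d) := s :* e :* d) refl (permSign π′) (sign p) (det A) ⟩
  sign p * permSign π′ * det A      ∎
  where
  open ≡-Reasoning
  p : Fin (suc n)
  p = π ⟨$⟩ʳ zero
  π′ : Permutation′ n
  π′ = remove zero π
  B : Matrix (suc n)
  B i = A (rotate p i)
  decompose : ∀ i → π ⟨$⟩ʳ i ≡ rotate p (lift₀ π′ ⟨$⟩ʳ i)
  decompose zero    = refl
  decompose (suc i) = punchIn-permute π zero i

det-permuteCols : ∀ {n} (π : Permutation′ n) (A : Matrix n) → det (λ i j → A i (π ⟨$⟩ʳ j)) ≡ permSign π * det A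
det-permuteCols π A = begin
  det (λ i j → A i (π ⟨$⟩ʳ j))                  ≡⟨ sym (det-transpose (λ i j → A i (π ⟨$⟩ʳ j))) ⟩
  det (λ i → transpose A (π ⟨$⟩ʳ i))            ≡⟨ det-permuteRows π (transpose A) ⟩
  permSign π * det (transpose A)                ≡⟨ cong (permSign π *_) (det-transpose A) ⟩
  permSign π * det A                            ∎
  where open ≡-Reasoning

det-conjugate : ∀ {n} (π : Permutation′ n) (A : Matrix n) → det (λ i j → A (π ⟨$⟩ʳ i) (π ⟨$⟩ʳ j)) ≡ det A
det-conjugate π A = begin
  det (λ i j → A (π ⟨$⟩ʳ i) (π ⟨$⟩ʳ j))     ≡⟨ det-permuteRows π (λ i j → A i (π ⟨$⟩ʳ j)) ⟩
  permSign π * det (λ i j → A i (π ⟨$⟩ʳ j)) ≡⟨ cong (permSign π *_) (det-permuteCols π A) ⟩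
  permSign π * (permSign π * det A)         ≡⟨ sym (*-assoc (permSign π) (permSign π) (det A)) ⟩
  permSign π * permSign π * det A           ≡⟨ cong (_* det A) (permSign*permSign≡1 π) ⟩
  1ℤ * det A                                ≡⟨ *-identityˡ (det A) ⟩
  det A                                     ∎
  where open ≡-Reasoning

det-reindex : ∀ {m n} (π : Permutation m n) (A : Matrix n) → det (λ i j → A (π ⟨$⟩ʳ i) (π ⟨$⟩ʳ j)) ≡ det A
det-reindex π = reindex (↔⇒≡ π) π
  where
  reindex : ∀ {m n} → m ≡ n → (π : Permutation m n) (A : Matrix n) → det (λ i j → A (π ⟨$⟩ʳ i) (π ⟨$⟩ʳ j)) ≡ det A
  reindex refl = det-conjugate

-- Block structure and cut vertices

replaceRow₀ : ∀ {n} → (Fin (suc n) → ℤ) → Matrix (suc n) → Matrix (suc n)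
replaceRow₀ u A zero    = u
replaceRow₀ u A (suc i) = A (suc i)

det-replaceRow₀-+ : ∀ {n} (A : Matrix (suc n)) (u v : Fin (suc n) → ℤ) → (∀ j → A zero j ≡ u j + v j) →
  det A ≡ det (replaceRow₀ u A) + det (replaceRow₀ v A)
det-replaceRow₀-+ {n} A u v A₀≡u+v = begin
  det A                                                  ≡⟨ det-laplace A ⟩
  ∑[ j < suc n ] (sign j * (A zero j * det (minor A j)))
    ≡⟨ sum-cong-≗ (λ j → trans (cong (λ a → sign j * (a * det (minor A j))) (A₀≡u+v j)) (distrib (sign j) (u j) (v j) _)) ⟩
  ∑[ j < suc n ] (sign j * (u j * det (minor A j)) + sign j * (v j * det (minor A j)))
    ≡⟨ ∑-distrib-+ (λ j → sign j * (u j * det (minor A j))) (λ j → sign j * (v j * det (minor A j))) ⟩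
  ∑[ j < suc n ] (sign j * (u j * det (minor A j))) + ∑[ j < suc n ] (sign j * (v j * det (minor A j)))
    ≡⟨ sym (cong₂ _+_ (det-laplace (replaceRow₀ u A)) (det-laplace (replaceRow₀ v A))) ⟩
  det (replaceRow₀ u A) + det (replaceRow₀ v A)          ∎
  where
  open ≡-Reasoning
  distrib : ∀ s x y d → s * ((x + y) * d) ≡ s * (x * d) + s * (y * d)
  distrib = solve 4 (λ s x y d → s :* ((x :+ y) :* d) := s :* (x :* d) :+ s :* (y :* d)) refl

sign-↑ˡ : ∀ {k} a (i : Fin k) → sign (i ↑ˡ a) ≡ sign i
sign-↑ˡ a zero    = refl
sign-↑ˡ a (suc i) = cong -_ (sign-↑ˡ a i)

punchIn-↑ˡ : ∀ {k} a (i : Fin (suc k)) (j : Fin k) → punchIn (i ↑ˡ a) (j ↑ˡ a) ≡ punchIn i j ↑ˡ a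
punchIn-↑ˡ a zero    j       = refl
punchIn-↑ˡ a (suc i) zero    = refl
punchIn-↑ˡ a (suc i) (suc j) = cong suc (punchIn-↑ˡ a i j)

punchIn-↑ʳ : ∀ {k} a (i : Fin (suc k)) (l : Fin a) → punchIn (i ↑ˡ a) (k ↑ʳ l) ≡ suc k ↑ʳ l
punchIn-↑ʳ         a zero    l = refl
punchIn-↑ʳ {suc k} a (suc i) l = cong suc (punchIn-↑ʳ a i l)

det-blockLowerTriangular : ∀ k {a} (N : Matrix (k +ℕ a)) → (∀ i l → N (i ↑ˡ a) (k ↑ʳ l) ≡ 0ℤ) →
  det N ≡ det (λ i j → N (i ↑ˡ a) (j ↑ˡ a)) * det (λ i j → N (k ↑ʳ i) (k ↑ʳ j))
det-blockLowerTriangular zero    N _ = sym (*-identityˡ (det N))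
det-blockLowerTriangular (suc k) {a} N upperRight≡0 = begin
  det N                                                      ≡⟨ det-laplace N ⟩
  sum term                                                   ≡⟨ sum-↑ (suc k) term ⟩
  ∑[ i < suc k ] term (i ↑ˡ a) + ∑[ l < a ] term (suc k ↑ʳ l)
    ≡⟨ cong₂ _+_ (sum-cong-≗ leftTerm) (sum-zero (λ l → term (suc k ↑ʳ l)) rightTerm) ⟩
  ∑[ i < suc k ] (sign i * (TL zero i * det (minor TL i)) * det BR) + 0ℤ
    ≡⟨ +-identityʳ _ ⟩
  ∑[ i < suc k ] (sign i * (TL zero i * det (minor TL i)) * det BR)
    ≡⟨ sym (*-distribʳ-sum (det BR) (λ i → sign i * (TL zero i * det (minor TL i)))) ⟩
  ∑[ i < suc k ] (sign i * (TL zero i * det (minor TL i))) * det BR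
    ≡⟨ cong (_* det BR) (sym (det-laplace TL)) ⟩
  det TL * det BR                                            ∎
  where
  open ≡-Reasoning
  TL : Matrix (suc k)
  TL i j = N (i ↑ˡ a) (j ↑ˡ a)
  BR : Matrix a
  BR i j = N (suc k ↑ʳ i) (suc k ↑ʳ j)
  term : Fin (suc k +ℕ a) → ℤ
  term x = sign x * (N zero x * det (minor N x))
  rightTerm : ∀ l → term (suc k ↑ʳ l) ≡ 0ℤ
  rightTerm l = trans (cong (λ e → sign (suc k ↑ʳ l) * (e * det (minor N (suc k ↑ʳ l)))) (upperRight≡0 zero l))
                      (*-zeroʳ (sign (suc k ↑ʳ l)))
  minor≡ : ∀ i → det (minor N (i ↑ˡ a)) ≡ det (minor TL i) * det BR
  minor≡ i = begin
    det (minor N (i ↑ˡ a))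
      ≡⟨ det-blockLowerTriangular k (minor N (i ↑ˡ a))
           (λ i′ l → trans (cong (N (suc (i′ ↑ˡ a))) (punchIn-↑ʳ a i l)) (upperRight≡0 (suc i′) l)) ⟩
    det (λ i′ j′ → N (suc (i′ ↑ˡ a)) (punchIn (i ↑ˡ a) (j′ ↑ˡ a))) * det (λ k′ l′ → N (suc (k ↑ʳ k′)) (punchIn (i ↑ˡ a) (k ↑ʳ l′)))
      ≡⟨ cong₂ _*_ (det-cong (λ i′ j′ → cong (N (suc (i′ ↑ˡ a))) (punchIn-↑ˡ a i j′)))
                   (det-cong (λ k′ l′ → cong (N (suc (k ↑ʳ k′))) (punchIn-↑ʳ a i l′))) ⟩
    det (minor TL i) * det BR ∎
  leftTerm : ∀ i → term (i ↑ˡ a) ≡ sign i * (TL zero i * det (minor TL i)) * det BR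
  leftTerm i = begin
    sign (i ↑ˡ a) * (TL zero i * det (minor N (i ↑ˡ a)))
      ≡⟨ cong₂ (λ s d → s * (TL zero i * d)) (sign-↑ˡ a i) (minor≡ i) ⟩
    sign i * (TL zero i * (det (minor TL i) * det BR))
      ≡⟨ solve 4 (λ s t m b → s :* (t :* (m :* b)) := s :* (t :* m) :* b) refl (sign i) (TL zero i) (det (minor TL i)) (det BR) ⟩
    sign i * (TL zero i * det (minor TL i)) * det BR ∎

det-blockUpperTriangular : ∀ k {a} (N : Matrix (k +ℕ a)) → (∀ l i → N (k ↑ʳ l) (i ↑ˡ a) ≡ 0ℤ) →
  det N ≡ det (λ i j → N (i ↑ˡ a) (j ↑ˡ a)) * det (λ i j → N (k ↑ʳ i) (k ↑ʳ j))
det-blockUpperTriangular k {a} N lowerLeft≡0 = begin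
  det N                  ≡⟨ sym (det-transpose N) ⟩
  det (transpose N)      ≡⟨ det-blockLowerTriangular k (transpose N) (λ i l → lowerLeft≡0 l i) ⟩
  det (transpose (λ i j → N (i ↑ˡ a) (j ↑ˡ a))) * det (transpose (λ i j → N (k ↑ʳ i) (k ↑ʳ j)))
    ≡⟨ cong₂ _*_ (det-transpose (λ i j → N (i ↑ˡ a) (j ↑ˡ a))) (det-transpose (λ i j → N (k ↑ʳ i) (k ↑ʳ j))) ⟩
  det (λ i j → N (i ↑ˡ a) (j ↑ˡ a)) * det (λ i j → N (k ↑ʳ i) (k ↑ʳ j)) ∎
  where open ≡-Reasoning

↑-induction : ∀ m {n} (P : Fin (m +ℕ n) → Set) → (∀ i → P (i ↑ˡ n)) → (∀ k → P (m ↑ʳ k)) → ∀ x → P x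
↑-induction m {n} P P↑ˡ P↑ʳ x = subst P (join-splitAt m n x) (byCases (splitAt m x))
  where
  byCases : ∀ e → P (join m n e)
  byCases (inj₁ i) = P↑ˡ i
  byCases (inj₂ k) = P↑ʳ k

bordered : ∀ {n} → ℤ → (Fin n → ℤ) → (Fin n → ℤ) → Matrix n → Matrix (suc n)
bordered c row col B zero    zero    = c
bordered c row col B zero    (suc j) = row j
bordered c row col B (suc i) zero    = col i
bordered c row col B (suc i) (suc j) = B i j

-- Index 0 is the cut vertex, followed by the vertices of X and then those of Y.
module CutVertex {m a : ℕ} (N : Matrix (suc (m +ℕ a))) where

  X : Matrix m
  X i j = N (suc (i ↑ˡ a)) (suc (j ↑ˡ a))

  Y : Matrix a
  Y k l = N (suc (m ↑ʳ k)) (suc (m ↑ʳ l))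

  X₀ : ℤ → Matrix (suc m)
  X₀ c = bordered c (λ j → N zero (suc (j ↑ˡ a))) (λ i → N (suc (i ↑ˡ a)) zero) X

  Y₀ : ℤ → Matrix (suc a)
  Y₀ c = bordered c (λ l → N zero (suc (m ↑ʳ l))) (λ k → N (suc (m ↑ʳ k)) zero) Y

  private
    rowX : ℤ → Fin (suc (m +ℕ a)) → ℤ
    rowX q zero    = q
    rowX q (suc x) = [ (λ _ → N zero (suc x)) , (λ _ → 0ℤ) ]′ (splitAt m x)

    rowY : ℤ → Fin (suc (m +ℕ a)) → ℤ
    rowY s zero    = s
    rowY s (suc x) = [ (λ _ → 0ℤ) , (λ _ → N zero (suc x)) ]′ (splitAt m x)

    toY₀ : Fin (suc a) → Fin (suc (m +ℕ a))
    toY₀ zero    = zero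
    toY₀ (suc k) = suc (m ↑ʳ k)

    -- Moves the cut vertex from the front to between X and Y.
    moveCut : Fin (m +ℕ suc a) → Fin (suc (m +ℕ a))
    moveCut x = [ (λ i → suc (i ↑ˡ a)) , toY₀ ]′ (splitAt m x)

    moveCut⁻¹ : Fin (suc (m +ℕ a)) → Fin (m +ℕ suc a)
    moveCut⁻¹ zero    = m ↑ʳ zero
    moveCut⁻¹ (suc x) = [ (λ i → i ↑ˡ suc a) , (λ k → m ↑ʳ suc k) ]′ (splitAt m x)

    moveCut-↑ˡ : ∀ i → moveCut (i ↑ˡ suc a) ≡ suc (i ↑ˡ a)
    moveCut-↑ˡ i rewrite splitAt-↑ˡ m i (suc a) = refl

    moveCut-↑ʳ : ∀ k → moveCut (m ↑ʳ k) ≡ toY₀ k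
    moveCut-↑ʳ k rewrite splitAt-↑ʳ m (suc a) k = refl

    moveCut⁻¹-↑ˡ : ∀ i → moveCut⁻¹ (suc (i ↑ˡ a)) ≡ i ↑ˡ suc a
    moveCut⁻¹-↑ˡ i rewrite splitAt-↑ˡ m i a = refl

    moveCut⁻¹-↑ʳ : ∀ k → moveCut⁻¹ (suc (m ↑ʳ k)) ≡ m ↑ʳ suc k
    moveCut⁻¹-↑ʳ k rewrite splitAt-↑ʳ m a k = refl

    σ : Permutation (m +ℕ suc a) (suc (m +ℕ a))
    σ = permutation moveCut moveCut⁻¹ moveCut∘moveCut⁻¹ moveCut⁻¹∘moveCut
      where
      moveCut∘moveCut⁻¹ : ∀ y → moveCut (moveCut⁻¹ y) ≡ y
      moveCut∘moveCut⁻¹ zero    = moveCut-↑ʳ zero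
      moveCut∘moveCut⁻¹ (suc x) = ↑-induction m (λ x → moveCut (moveCut⁻¹ (suc x)) ≡ suc x)
        (λ i → trans (cong moveCut (moveCut⁻¹-↑ˡ i)) (moveCut-↑ˡ i))
        (λ k → trans (cong moveCut (moveCut⁻¹-↑ʳ k)) (moveCut-↑ʳ (suc k))) x
      moveCut⁻¹∘moveCut : ∀ x → moveCut⁻¹ (moveCut x) ≡ x
      moveCut⁻¹∘moveCut = ↑-induction m (λ x → moveCut⁻¹ (moveCut x) ≡ x)
        (λ i → trans (cong moveCut⁻¹ (moveCut-↑ˡ i)) (moveCut⁻¹-↑ˡ i))
        (λ { zero → cong moveCut⁻¹ (moveCut-↑ʳ zero) ; (suc k) → trans (cong moveCut⁻¹ (moveCut-↑ʳ (suc k))) (moveCut⁻¹-↑ʳ k) })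

  -- Split row 0 into its X-part (with corner q) and its Y-part (with corner s).
  -- The first summand is block triangular for the order (0 ∪ X, Y), the second
  -- for the order (X, 0 ∪ Y).
  det-cutVertex : ∀ q s → N zero zero ≡ q + s →
    (∀ i k → N (suc (i ↑ˡ a)) (suc (m ↑ʳ k)) ≡ 0ℤ) → (∀ k i → N (suc (m ↑ʳ k)) (suc (i ↑ˡ a)) ≡ 0ℤ) →
    det N ≡ det (X₀ q) * det Y + det X * det (Y₀ s)
  det-cutVertex q s N₀₀≡q+s X→Y≡0 Y→X≡0 = begin
    det N                                              ≡⟨ det-replaceRow₀-+ N (rowX q) (rowY s) rowSplit ⟩
    det (replaceRow₀ (rowX q) N) + det (replaceRow₀ (rowY s) N) ≡⟨ cong₂ _+_ det-X-part det-Y-part ⟩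
    det (X₀ q) * det Y + det X * det (Y₀ s)            ∎
    where
    open ≡-Reasoning
    rowSplit : ∀ x → N zero x ≡ rowX q x + rowY s x
    rowSplit zero    = N₀₀≡q+s
    rowSplit (suc x) with splitAt m x
    ... | inj₁ _ = sym (+-identityʳ _)
    ... | inj₂ _ = sym (+-identityˡ _)

    det-X-part : det (replaceRow₀ (rowX q) N) ≡ det (X₀ q) * det Y
    det-X-part = trans (det-blockLowerTriangular (suc m) (replaceRow₀ (rowX q) N) upperRight≡0)
                       (cong (_* det Y) (det-cong topLeft≡X₀))
      where
      upperRight≡0 : ∀ i l → replaceRow₀ (rowX q) N (i ↑ˡ a) (suc m ↑ʳ l) ≡ 0ℤ
      upperRight≡0 zero    l rewrite splitAt-↑ʳ m a l = refl
      upperRight≡0 (suc i) l = X→Y≡0 i l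
      topLeft≡X₀ : ∀ i j → replaceRow₀ (rowX q) N (i ↑ˡ a) (j ↑ˡ a) ≡ X₀ q i j
      topLeft≡X₀ zero    zero    = refl
      topLeft≡X₀ zero    (suc j) rewrite splitAt-↑ˡ m j a = refl
      topLeft≡X₀ (suc i) zero    = refl
      topLeft≡X₀ (suc i) (suc j) = refl

    det-Y-part : det (replaceRow₀ (rowY s) N) ≡ det X * det (Y₀ s)
    det-Y-part = begin
      det NY                                                 ≡⟨ sym (det-reindex σ NY) ⟩
      det (λ x y → NY (σ ⟨$⟩ʳ x) (σ ⟨$⟩ʳ y))                  ≡⟨ det-blockUpperTriangular m (λ x y → NY (σ ⟨$⟩ʳ x) (σ ⟨$⟩ʳ y)) lowerLeft≡0 ⟩
      det (λ i j → NY (σ ⟨$⟩ʳ (i ↑ˡ suc a)) (σ ⟨$⟩ʳ (j ↑ˡ suc a))) * det (λ k l → NY (σ ⟨$⟩ʳ (m ↑ʳ k)) (σ ⟨$⟩ʳ (m ↑ʳ l)))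
        ≡⟨ cong₂ _*_ (det-cong (λ i j → cong₂ NY (moveCut-↑ˡ i) (moveCut-↑ˡ j)))
                     (det-cong (λ k l → trans (cong₂ NY (moveCut-↑ʳ k) (moveCut-↑ʳ l)) (bottomRight≡Y₀ k l))) ⟩
      det X * det (Y₀ s)                                     ∎
      where
      NY : Matrix (suc (m +ℕ a))
      NY = replaceRow₀ (rowY s) N
      lowerLeft≡0 : ∀ l i → NY (σ ⟨$⟩ʳ (m ↑ʳ l)) (σ ⟨$⟩ʳ (i ↑ˡ suc a)) ≡ 0ℤ
      lowerLeft≡0 l i rewrite moveCut-↑ʳ l | moveCut-↑ˡ i = fromY₀ l
        where
        fromY₀ : ∀ l → NY (toY₀ l) (suc (i ↑ˡ a)) ≡ 0ℤ
        fromY₀ zero    rewrite splitAt-↑ˡ m i a = refl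
        fromY₀ (suc k) = Y→X≡0 k i
      bottomRight≡Y₀ : ∀ k l → NY (toY₀ k) (toY₀ l) ≡ Y₀ s k l
      bottomRight≡Y₀ zero    zero    = refl
      bottomRight≡Y₀ zero    (suc l) rewrite splitAt-↑ʳ m a l = refl
      bottomRight≡Y₀ (suc k) zero    = refl
      bottomRight≡Y₀ (suc k) (suc l) = refl

-- Partially expanded rooted products

⌊≟⌋-refl : ∀ {n} (i : Fin n) → ⌊ i ≟ i ⌋ ≡ true
⌊≟⌋-refl i with i ≟ i
... | yes _   = refl
... | no i≢i = ⊥-elim (i≢i refl)

⌊≟⌋-≢ : ∀ {n} {i j : Fin n} → i ≢ j → ⌊ i ≟ j ⌋ ≡ false
⌊≟⌋-≢ {i = i} {j} i≢j with i ≟ j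
... | yes i≡j = ⊥-elim (i≢j i≡j)
... | no _    = refl

≟-injective : ∀ {A B : Set} (_≟A_ : DecidableEquality A) (_≟B_ : DecidableEquality B) (f : A → B) →
  (∀ {a a′} → f a ≡ f a′ → a ≡ a′) → ∀ a a′ → ⌊ f a ≟B f a′ ⌋ ≡ ⌊ a ≟A a′ ⌋
≟-injective _≟A_ _≟B_ f f-injective a a′ with a ≟A a′ | f a ≟B f a′
... | yes _    | yes _      = refl
... | yes refl | no fa≢fa   = ⊥-elim (fa≢fa refl)
... | no a≢a′ | yes fa≡fa′ = ⊥-elim (a≢a′ (f-injective fa≡fa′))
... | no _     | no _       = refl

charMat : ∀ {n} → Matrix n → ℤ → Matrix n
charMat A x i j = (if ⌊ i ≟ j ⌋ then x else 0ℤ) - A i j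

charMat-deleteMat : ∀ {n} (A : Matrix (suc n)) r x i j →
  charMat A x (punchIn r i) (punchIn r j) ≡ charMat (deleteMat A r) x i j
charMat-deleteMat A r x i j =
  cong (λ b → (if b then x else 0ℤ) - deleteMat A r i j) (≟-injective _≟_ _≟_ (punchIn r) (punchIn-injective r _ _) i j)

-- The vertices of a rooted product Σ[Π] in which only n of the t + n base
-- vertices carry a copy of Π (on m vertices); the other t base vertices stay bare.
Vertex : ℕ → ℕ → ℕ → Set
Vertex t n m = Fin t ⊎ (Fin n × Fin m)

_≟ᵥ_ : ∀ {t n m} → DecidableEquality (Vertex t n m)
_≟ᵥ_ = SumP.≡-dec _≟_ (ProdP.≡-dec _≟_ _≟_)

module _ {t n m : ℕ} where

  vertices : Fin (t +ℕ n *ℕ m) ↔ Vertex t n m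
  vertices = ⊎-cong (↔-id _) *↔× ↔-∘ +↔⊎

  toVertex : Fin (t +ℕ n *ℕ m) → Vertex t n m
  toVertex = Inverse.to vertices

  fromVertex : Vertex t n m → Fin (t +ℕ n *ℕ m)
  fromVertex = Inverse.from vertices

  toVertex-fromVertex : ∀ v → toVertex (fromVertex v) ≡ v
  toVertex-fromVertex = Inverse.strictlyInverseˡ vertices

  fromVertex-toVertex : ∀ y → fromVertex (toVertex y) ≡ y
  fromVertex-toVertex = Inverse.strictlyInverseʳ vertices

  toVertex-injective : ∀ {y z} → toVertex y ≡ toVertex z → y ≡ z
  toVertex-injective {y} {z} y≡z = trans (sym (fromVertex-toVertex y)) (trans (cong fromVertex y≡z) (fromVertex-toVertex z))

liftCopy : ∀ {t n m} → Vertex t n m → Vertex t (suc n) m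
liftCopy (inj₁ c)       = inj₁ c
liftCopy (inj₂ (i , j)) = inj₂ (suc i , j)

liftCopy-injective : ∀ {t n m} {v w : Vertex t n m} → liftCopy v ≡ liftCopy w → v ≡ w
liftCopy-injective {v = inj₁ _}     {inj₁ _}     refl = refl
liftCopy-injective {v = inj₂ (_ , _)} {inj₂ (_ , _)} refl = refl

shiftBare : ∀ {t n m} → Vertex t n m → Vertex (suc t) n m
shiftBare (inj₁ c) = inj₁ (suc c)
shiftBare (inj₂ p) = inj₂ p

shiftBare-injective : ∀ {t n m} {v w : Vertex t n m} → shiftBare v ≡ shiftBare w → v ≡ w
shiftBare-injective {v = inj₁ _} {inj₁ _} refl = refl
shiftBare-injective {v = inj₂ _} {inj₂ _} refl = refl

toVertex-suc : ∀ {t n m} (y : Fin (t +ℕ n *ℕ m)) → toVertex {suc t} {n} {m} (suc y) ≡ shiftBare (toVertex y)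
toVertex-suc {t} y with splitAt t y
... | inj₁ _ = refl
... | inj₂ _ = refl

BaseMatrix : ℕ → ℕ → Set
BaseMatrix t n = Fin t ⊎ Fin n → Fin t ⊎ Fin n → ℤ

-- The base vertex inj₂ zero, together with its copy, is deleted …
dropFirst : ∀ {t n} → BaseMatrix t (suc n) → BaseMatrix t n
dropFirst B v w = B (Sum.map₂ suc v) (Sum.map₂ suc w)

-- … or it stays, but becomes the bare vertex inj₁ zero.
bareFirst : ∀ {t n} → BaseMatrix t (suc n) → BaseMatrix (suc t) n
bareFirst B v w = B (unexpand v) (unexpand w)
  where
  unexpand : Fin (suc _) ⊎ Fin _ → Fin _ ⊎ Fin (suc _)
  unexpand (inj₁ zero)    = inj₂ zero
  unexpand (inj₁ (suc c)) = inj₁ c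
  unexpand (inj₂ i)       = inj₂ (suc i)

expandAll : ∀ {n} → Matrix n → BaseMatrix 0 n
expandAll S (inj₂ i) (inj₂ i′) = S i i′

module PartialRootedProduct {m : ℕ} (P : Matrix m) (r : Fin m) (x : ℤ) where

  -- Bare vertices carry no x on the diagonal: a bare vertex is the root of a copy
  -- that has already been peeled off, and its x went into charPoly P x.
  weight : ∀ {t n} → Vertex t n m → ℤ
  weight (inj₁ _) = 0ℤ
  weight (inj₂ _) = x

  adjacency : ∀ {t n} → BaseMatrix t n → Vertex t n m → Vertex t n m → ℤ
  adjacency B (inj₁ c)       (inj₁ c′)        = B (inj₁ c) (inj₁ c′)
  adjacency B (inj₁ c)       (inj₂ (i′ , j′)) = if ⌊ j′ ≟ r ⌋ then B (inj₁ c) (inj₂ i′) else 0ℤ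
  adjacency B (inj₂ (i , j)) (inj₁ c′)        = if ⌊ j ≟ r ⌋ then B (inj₂ i) (inj₁ c′) else 0ℤ
  adjacency B (inj₂ (i , j)) (inj₂ (i′ , j′)) =
    (if ⌊ i ≟ i′ ⌋ then P j j′ else 0ℤ) + (if ⌊ j ≟ r ⌋ then (if ⌊ j′ ≟ r ⌋ then B (inj₂ i) (inj₂ i′) else 0ℤ) else 0ℤ)

  charEntry : ∀ {t n} → BaseMatrix t n → Vertex t n m → Vertex t n m → ℤ
  charEntry B v w = (if ⌊ v ≟ᵥ w ⌋ then weight v else 0ℤ) - adjacency B v w

  partialCharMat : ∀ {t n} → BaseMatrix t n → Matrix (t +ℕ n *ℕ m)
  partialCharMat B y z = charEntry B (toVertex y) (toVertex z)

  charEntry-≢ : ∀ {t n} (B : BaseMatrix t n) {v w} → v ≢ w → charEntry B v w ≡ - adjacency B v w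
  charEntry-≢ B {v} {w} v≢w with v ≟ᵥ w
  ... | yes v≡w = ⊥-elim (v≢w v≡w)
  ... | no _    = +-identityˡ _

  charEntry-embed : ∀ {t n t′ n′} (B : BaseMatrix t n) (B′ : BaseMatrix t′ n′) (f : Vertex t n m → Vertex t′ n′ m) →
    (∀ {v w} → f v ≡ f w → v ≡ w) → (∀ v → weight (f v) ≡ weight v) →
    (∀ v w → adjacency B′ (f v) (f w) ≡ adjacency B v w) → ∀ v w → charEntry B′ (f v) (f w) ≡ charEntry B v w
  charEntry-embed B B′ f f-injective weight∘f adjacency∘f v w = cong₂ _-_
    (cong₂ (λ b e → if b then e else 0ℤ) (≟-injective _≟ᵥ_ _≟ᵥ_ f f-injective v w) (weight∘f v)) (adjacency∘f v w)

  charEntry-liftCopy : ∀ {t n} (B : BaseMatrix t (suc n)) v w →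
    charEntry B (liftCopy v) (liftCopy w) ≡ charEntry (dropFirst B) v w
  charEntry-liftCopy B = charEntry-embed (dropFirst B) B liftCopy liftCopy-injective weight-liftCopy adjacency-liftCopy
    where
    weight-liftCopy : ∀ v → weight (liftCopy v) ≡ weight v
    weight-liftCopy (inj₁ _) = refl
    weight-liftCopy (inj₂ _) = refl
    adjacency-liftCopy : ∀ v w → adjacency B (liftCopy v) (liftCopy w) ≡ adjacency (dropFirst B) v w
    adjacency-liftCopy (inj₁ _) (inj₁ _) = refl
    adjacency-liftCopy (inj₁ _) (inj₂ _) = refl
    adjacency-liftCopy (inj₂ _) (inj₁ _) = refl
    adjacency-liftCopy (inj₂ (i , j)) (inj₂ (i′ , j′)) =
      cong (λ b → (if b then P j j′ else 0ℤ) + (if ⌊ j ≟ r ⌋ then (if ⌊ j′ ≟ r ⌋ then B (inj₂ (suc i)) (inj₂ (suc i′)) else 0ℤ) else 0ℤ))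
           (≟-injective _≟_ _≟_ suc suc-injective i i′)

  charEntry-shiftBare : ∀ {t n} (B : BaseMatrix t (suc n)) v w →
    charEntry (bareFirst B) (shiftBare v) (shiftBare w) ≡ charEntry (dropFirst B) v w
  charEntry-shiftBare B = charEntry-embed (dropFirst B) (bareFirst B) shiftBare shiftBare-injective weight-shiftBare adjacency-shiftBare
    where
    weight-shiftBare : ∀ v → weight (shiftBare v) ≡ weight v
    weight-shiftBare (inj₁ _) = refl
    weight-shiftBare (inj₂ _) = refl
    adjacency-shiftBare : ∀ v w → adjacency (bareFirst B) (shiftBare v) (shiftBare w) ≡ adjacency (dropFirst B) v w
    adjacency-shiftBare (inj₁ _) (inj₁ _) = refl
    adjacency-shiftBare (inj₁ _) (inj₂ _) = refl
    adjacency-shiftBare (inj₂ _) (inj₁ _) = refl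
    adjacency-shiftBare (inj₂ _) (inj₂ _) = refl

charPoly-rootedProduct : ∀ {n m} (S : Matrix n) (P : Matrix m) r x →
  charPoly (rootedProductMat S P r) x ≡ det (PartialRootedProduct.partialCharMat P r x (expandAll S))
charPoly-rootedProduct {n} {m} S P r x = det-cong (λ y z →
  cong (λ b → (if b then x else 0ℤ) - rootedProductMat S P r y z)
       (sym (≟-injective _≟_ _≟ᵥ_ (toVertex {0} {n} {m}) toVertex-injective y z)))

module PeelLayout {m t n : ℕ} (r : Fin (suc m)) where

  a : ℕ
  a = t +ℕ n *ℕ suc m

  copy₀ : Fin (suc m) → Vertex t (suc n) (suc m)
  copy₀ j = inj₂ (zero , j)

  ρ : Permutation′ (suc m)
  ρ = insert zero r idₚ

  -- The order expected by CutVertex: the root of copy 0, the rest of copy 0, all other vertices.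
  layout : Fin (suc m +ℕ a) → Vertex t (suc n) (suc m)
  layout y = [ (λ j → copy₀ (ρ ⟨$⟩ʳ j)) , (λ z → liftCopy (toVertex z)) ]′ (splitAt (suc m) y)

  layout⁻¹ : Vertex t (suc n) (suc m) → Fin (suc m +ℕ a)
  layout⁻¹ (inj₁ c)           = suc m ↑ʳ fromVertex {t} {n} (inj₁ c)
  layout⁻¹ (inj₂ (zero , j))  = (ρ ⟨$⟩ˡ j) ↑ˡ a
  layout⁻¹ (inj₂ (suc i , j)) = suc m ↑ʳ fromVertex {t} {n} (inj₂ (i , j))

  layout-↑ˡ : ∀ j → layout (j ↑ˡ a) ≡ copy₀ (ρ ⟨$⟩ʳ j)
  layout-↑ˡ j rewrite splitAt-↑ˡ (suc m) j a = refl

  layout-↑ʳ : ∀ z → layout (suc m ↑ʳ z) ≡ liftCopy (toVertex z)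
  layout-↑ʳ z rewrite splitAt-↑ʳ (suc m) a z = refl

  layout∘layout⁻¹ : ∀ v → layout (layout⁻¹ v) ≡ v
  layout∘layout⁻¹ (inj₁ c)           = trans (layout-↑ʳ (fromVertex {t} {n} (inj₁ c))) (cong liftCopy (toVertex-fromVertex {t} {n} {suc m} (inj₁ c)))
  layout∘layout⁻¹ (inj₂ (zero , j))  = trans (layout-↑ˡ (ρ ⟨$⟩ˡ j)) (cong copy₀ (inverseʳ ρ {j}))
  layout∘layout⁻¹ (inj₂ (suc i , j)) = trans (layout-↑ʳ (fromVertex {t} {n} (inj₂ (i , j)))) (cong liftCopy (toVertex-fromVertex {t} {n} {suc m} (inj₂ (i , j))))

  layout⁻¹∘layout : ∀ y → layout⁻¹ (layout y) ≡ y
  layout⁻¹∘layout = ↑-induction (suc m) (λ y → layout⁻¹ (layout y) ≡ y)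
    (λ j → trans (cong layout⁻¹ (layout-↑ˡ j)) (cong (_↑ˡ a) (inverseˡ ρ {j})))
    (λ z → trans (cong layout⁻¹ (layout-↑ʳ z)) (trans (layout⁻¹-liftCopy (toVertex z)) (cong (suc m ↑ʳ_) (fromVertex-toVertex {t} {n} {suc m} z))))
    where
    layout⁻¹-liftCopy : ∀ v → layout⁻¹ (liftCopy v) ≡ suc m ↑ʳ fromVertex {t} {n} v
    layout⁻¹-liftCopy (inj₁ _) = refl
    layout⁻¹-liftCopy (inj₂ _) = refl

  φ : Permutation (suc m +ℕ a) (t +ℕ suc n *ℕ suc m)
  φ = permutation (λ y → fromVertex (layout y)) (λ z → layout⁻¹ (toVertex z))
    (λ z → trans (cong fromVertex (layout∘layout⁻¹ (toVertex z))) (fromVertex-toVertex {t} {suc n} {suc m} z))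
    (λ y → trans (cong layout⁻¹ (toVertex-fromVertex (layout y))) (layout⁻¹∘layout y))

module Peel {m t n : ℕ} (P : Matrix (suc m)) (r : Fin (suc m)) (x : ℤ) (B : BaseMatrix t (suc n)) where
  open PartialRootedProduct P r x
  open PeelLayout {m} {t} {n} r

  N : Matrix (suc (m +ℕ a))
  N y z = charEntry B (layout y) (layout z)

  N≡ : ∀ y z {v w} → layout y ≡ v → layout z ≡ w → N y z ≡ charEntry B v w
  N≡ y z refl refl = refl

  B₀₀ : ℤ
  B₀₀ = B (inj₂ zero) (inj₂ zero)

  rootLoop : Fin (suc m) → Fin (suc m) → ℤ
  rootLoop j j′ = if ⌊ j ≟ r ⌋ then (if ⌊ j′ ≟ r ⌋ then B₀₀ else 0ℤ) else 0ℤ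

  charEntry-copy₀ : ∀ j j′ → charEntry B (copy₀ j) (copy₀ j′) ≡ charMat P x j j′ - rootLoop j j′
  charEntry-copy₀ j j′ = trans
    (cong (λ b → (if b then x else 0ℤ) - (P j j′ + rootLoop j j′)) (≟-injective _≟_ _≟ᵥ_ copy₀ copy₀-injective j j′))
    (solve 3 (λ d p l → d :- (p :+ l) := d :- p :- l) refl (if ⌊ j ≟ j′ ⌋ then x else 0ℤ) (P j j′) (rootLoop j j′))
    where
    copy₀-injective : ∀ {j j′} → copy₀ j ≡ copy₀ j′ → j ≡ j′
    copy₀-injective refl = refl

  charEntry-copy₀-off-root : ∀ j j′ → rootLoop j j′ ≡ 0ℤ → charEntry B (copy₀ j) (copy₀ j′) ≡ charMat P x j j′
  charEntry-copy₀-off-root j j′ loop≡0 = trans (charEntry-copy₀ j j′) (trans (cong (λ l → charMat P x j j′ - l) loop≡0) (+-identityʳ _))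

  rootLoop-punchInˡ : ∀ i j′ → rootLoop (punchIn r i) j′ ≡ 0ℤ
  rootLoop-punchInˡ i j′ rewrite ⌊≟⌋-≢ (punchInᵢ≢i r i) = refl

  rootLoop-punchInʳ : ∀ j i → rootLoop j (punchIn r i) ≡ 0ℤ
  rootLoop-punchInʳ j i rewrite ⌊≟⌋-≢ (punchInᵢ≢i r i) with ⌊ j ≟ r ⌋
  ... | true  = refl
  ... | false = refl

  rootLoop-root : rootLoop r r ≡ B₀₀
  rootLoop-root rewrite ⌊≟⌋-refl r = refl

  copy₀≢liftCopy : ∀ j v → copy₀ j ≢ liftCopy v
  copy₀≢liftCopy j (inj₁ _) ()
  copy₀≢liftCopy j (inj₂ _) ()

  liftCopy≢copy₀ : ∀ v j → liftCopy v ≢ copy₀ j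
  liftCopy≢copy₀ (inj₁ _) j ()
  liftCopy≢copy₀ (inj₂ _) j ()

  bare₀≢shiftBare : ∀ v → inj₁ zero ≢ shiftBare {t} {n} {suc m} v
  bare₀≢shiftBare (inj₁ _) ()
  bare₀≢shiftBare (inj₂ _) ()

  shiftBare≢bare₀ : ∀ v → shiftBare {t} {n} {suc m} v ≢ inj₁ zero
  shiftBare≢bare₀ (inj₁ _) ()
  shiftBare≢bare₀ (inj₂ _) ()

  adjacency-copy₀-liftCopy : ∀ i v → adjacency B (copy₀ (punchIn r i)) (liftCopy v) ≡ 0ℤ
  adjacency-copy₀-liftCopy i (inj₁ _) rewrite ⌊≟⌋-≢ (punchInᵢ≢i r i) = refl
  adjacency-copy₀-liftCopy i (inj₂ _) rewrite ⌊≟⌋-≢ (punchInᵢ≢i r i) = refl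

  adjacency-liftCopy-copy₀ : ∀ v i → adjacency B (liftCopy v) (copy₀ (punchIn r i)) ≡ 0ℤ
  adjacency-liftCopy-copy₀ (inj₁ _) i rewrite ⌊≟⌋-≢ (punchInᵢ≢i r i) = refl
  adjacency-liftCopy-copy₀ (inj₂ (_ , j)) i rewrite ⌊≟⌋-≢ (punchInᵢ≢i r i) with ⌊ j ≟ r ⌋
  ... | true  = refl
  ... | false = refl

  adjacency-root-liftCopy : ∀ v → adjacency B (copy₀ r) (liftCopy v) ≡ adjacency (bareFirst B) (inj₁ zero) (shiftBare v)
  adjacency-root-liftCopy (inj₁ _) rewrite ⌊≟⌋-refl r = refl
  adjacency-root-liftCopy (inj₂ _) rewrite ⌊≟⌋-refl r = +-identityˡ _

  adjacency-liftCopy-root : ∀ v → adjacency B (liftCopy v) (copy₀ r) ≡ adjacency (bareFirst B) (shiftBare v) (inj₁ zero)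
  adjacency-liftCopy-root (inj₁ _) rewrite ⌊≟⌋-refl r = refl
  adjacency-liftCopy-root (inj₂ _) rewrite ⌊≟⌋-refl r = +-identityˡ _

  open CutVertex {m} {a} N using (X; Y; X₀; Y₀; det-cutVertex)

  q s : ℤ
  q = charMat P x r r
  s = - B₀₀

  N₀₀≡q+s : N zero zero ≡ q + s
  N₀₀≡q+s = trans (charEntry-copy₀ r r) (cong (λ l → q - l) rootLoop-root)

  X→Y≡0 : ∀ i k → N (suc (i ↑ˡ a)) (suc (m ↑ʳ k)) ≡ 0ℤ
  X→Y≡0 i k = trans (N≡ (suc (i ↑ˡ a)) (suc (m ↑ʳ k)) (layout-↑ˡ (suc i)) (layout-↑ʳ k))
    (trans (charEntry-≢ B (copy₀≢liftCopy (punchIn r i) (toVertex k))) (cong -_ (adjacency-copy₀-liftCopy i (toVertex k))))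

  Y→X≡0 : ∀ k i → N (suc (m ↑ʳ k)) (suc (i ↑ˡ a)) ≡ 0ℤ
  Y→X≡0 k i = trans (N≡ (suc (m ↑ʳ k)) (suc (i ↑ˡ a)) (layout-↑ʳ k) (layout-↑ˡ (suc i)))
    (trans (charEntry-≢ B (liftCopy≢copy₀ (toVertex k) (punchIn r i))) (cong -_ (adjacency-liftCopy-copy₀ (toVertex k) i)))

  det-X₀ : det (X₀ q) ≡ charPoly P x
  det-X₀ = trans (det-cong X₀≡) (det-conjugate ρ (charMat P x))
    where
    X₀≡ : ∀ i j → X₀ q i j ≡ charMat P x (ρ ⟨$⟩ʳ i) (ρ ⟨$⟩ʳ j)
    X₀≡ zero    zero    = refl
    X₀≡ zero    (suc j) = trans (N≡ zero (suc (j ↑ˡ a)) refl (layout-↑ˡ (suc j))) (charEntry-copy₀-off-root r (punchIn r j) (rootLoop-punchInʳ r j))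
    X₀≡ (suc i) zero    = trans (N≡ (suc (i ↑ˡ a)) zero (layout-↑ˡ (suc i)) refl) (charEntry-copy₀-off-root (punchIn r i) r (rootLoop-punchInˡ i r))
    X₀≡ (suc i) (suc j) = trans (N≡ (suc (i ↑ˡ a)) (suc (j ↑ˡ a)) (layout-↑ˡ (suc i)) (layout-↑ˡ (suc j)))
                                (charEntry-copy₀-off-root (punchIn r i) (punchIn r j) (rootLoop-punchInˡ i (punchIn r j)))

  det-X : det X ≡ charPoly (deleteMat P r) x
  det-X = det-cong λ i j → trans (N≡ (suc (i ↑ˡ a)) (suc (j ↑ˡ a)) (layout-↑ˡ (suc i)) (layout-↑ˡ (suc j)))
    (trans (charEntry-copy₀-off-root (punchIn r i) (punchIn r j) (rootLoop-punchInˡ i (punchIn r j))) (charMat-deleteMat P r x i j))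

  det-Y : det Y ≡ det (partialCharMat (dropFirst B))
  det-Y = det-cong λ k l → trans (N≡ (suc (m ↑ʳ k)) (suc (m ↑ʳ l)) (layout-↑ʳ k) (layout-↑ʳ l)) (charEntry-liftCopy B (toVertex k) (toVertex l))

  det-Y₀ : det (Y₀ s) ≡ det (partialCharMat (bareFirst B))
  det-Y₀ = det-cong Y₀≡
    where
    Y₀≡ : ∀ k l → Y₀ s k l ≡ partialCharMat (bareFirst B) k l
    Y₀≡ zero    zero    = sym (+-identityˡ _)
    Y₀≡ zero    (suc l) = begin
      N zero (suc (m ↑ʳ l))                                        ≡⟨ N≡ zero (suc (m ↑ʳ l)) refl (layout-↑ʳ l) ⟩
      charEntry B (copy₀ r) (liftCopy (toVertex l))                ≡⟨ charEntry-≢ B (copy₀≢liftCopy r (toVertex l)) ⟩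
      - adjacency B (copy₀ r) (liftCopy (toVertex l))              ≡⟨ cong -_ (adjacency-root-liftCopy (toVertex l)) ⟩
      - adjacency (bareFirst B) (inj₁ zero) (shiftBare (toVertex l)) ≡⟨ sym (charEntry-≢ (bareFirst B) (bare₀≢shiftBare (toVertex l))) ⟩
      charEntry (bareFirst B) (inj₁ zero) (shiftBare (toVertex l)) ≡⟨ cong (charEntry (bareFirst B) (inj₁ zero)) (sym (toVertex-suc l)) ⟩
      partialCharMat (bareFirst B) zero (suc l)                    ∎
      where open ≡-Reasoning
    Y₀≡ (suc k) zero    = begin
      N (suc (m ↑ʳ k)) zero                                        ≡⟨ N≡ (suc (m ↑ʳ k)) zero (layout-↑ʳ k) refl ⟩
      charEntry B (liftCopy (toVertex k)) (copy₀ r)                ≡⟨ charEntry-≢ B (liftCopy≢copy₀ (toVertex k) r) ⟩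
      - adjacency B (liftCopy (toVertex k)) (copy₀ r)              ≡⟨ cong -_ (adjacency-liftCopy-root (toVertex k)) ⟩
      - adjacency (bareFirst B) (shiftBare (toVertex k)) (inj₁ zero) ≡⟨ sym (charEntry-≢ (bareFirst B) (shiftBare≢bare₀ (toVertex k))) ⟩
      charEntry (bareFirst B) (shiftBare (toVertex k)) (inj₁ zero) ≡⟨ cong (λ v → charEntry (bareFirst B) v (inj₁ zero)) (sym (toVertex-suc k)) ⟩
      partialCharMat (bareFirst B) (suc k) zero                    ∎
      where open ≡-Reasoning
    Y₀≡ (suc k) (suc l) = begin
      Y k l                                                        ≡⟨ N≡ (suc (m ↑ʳ k)) (suc (m ↑ʳ l)) (layout-↑ʳ k) (layout-↑ʳ l) ⟩
      charEntry B (liftCopy (toVertex k)) (liftCopy (toVertex l))  ≡⟨ charEntry-liftCopy B (toVertex k) (toVertex l) ⟩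
      charEntry (dropFirst B) (toVertex k) (toVertex l)            ≡⟨ sym (charEntry-shiftBare B (toVertex k) (toVertex l)) ⟩
      charEntry (bareFirst B) (shiftBare (toVertex k)) (shiftBare (toVertex l))
        ≡⟨ cong₂ (charEntry (bareFirst B)) (sym (toVertex-suc k)) (sym (toVertex-suc l)) ⟩
      partialCharMat (bareFirst B) (suc k) (suc l)                 ∎
      where open ≡-Reasoning

  det-partialCharMat-peel : det (partialCharMat B) ≡
    charPoly P x * det (partialCharMat (dropFirst B)) + charPoly (deleteMat P r) x * det (partialCharMat (bareFirst B))
  det-partialCharMat-peel = begin
    det (partialCharMat B)                                   ≡⟨ sym (det-reindex φ (partialCharMat B)) ⟩
    det (λ y z → partialCharMat B (φ ⟨$⟩ʳ y) (φ ⟨$⟩ʳ z))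
      ≡⟨ det-cong (λ y z → cong₂ (charEntry B) (toVertex-fromVertex (layout y)) (toVertex-fromVertex (layout z))) ⟩
    det N                                                    ≡⟨ det-cutVertex q s N₀₀≡q+s X→Y≡0 Y→X≡0 ⟩
    det (X₀ q) * det Y + det X * det (Y₀ s)                  ≡⟨ cong₂ _+_ (cong₂ _*_ det-X₀ det-Y) (cong₂ _*_ det-X det-Y₀) ⟩
    charPoly P x * det (partialCharMat (dropFirst B)) + charPoly (deleteMat P r) x * det (partialCharMat (bareFirst B)) ∎
    where open ≡-Reasoning

open PartialRootedProduct using (partialCharMat)

det-partialCharMat-cospectral : ∀ {m} {P P′ : Matrix (suc m)} {r r′ : Fin (suc m)} {x} →
  charPoly P x ≡ charPoly P′ x → charPoly (deleteMat P r) x ≡ charPoly (deleteMat P′ r′) x →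
  ∀ {t n} (B : BaseMatrix t n) → det (partialCharMat P r x B) ≡ det (partialCharMat P′ r′ x B)
det-partialCharMat-cospectral {P = P} {P′} {r} {r′} {x} _ _ {n = zero} B =
  det-cong (λ y z → bareEntries (toVertex y) (toVertex z))
  where
  bareEntries : ∀ v w → PartialRootedProduct.charEntry P r x B v w ≡ PartialRootedProduct.charEntry P′ r′ x B v w
  bareEntries (inj₁ _)        (inj₁ _)        = refl
  bareEntries (inj₁ _)        (inj₂ (() , _))
  bareEntries (inj₂ (() , _)) _
det-partialCharMat-cospectral {P = P} {P′} {r} {r′} {x} φ≡φ′ φ-r≡φ′-r′ {n = suc n} B = begin
  det (partialCharMat P r x B)
    ≡⟨ Peel.det-partialCharMat-peel P r x B ⟩
  charPoly P x * det (partialCharMat P r x (dropFirst B)) + charPoly (deleteMat P r) x * det (partialCharMat P r x (bareFirst B))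
    ≡⟨ cong₂ _+_ (cong₂ _*_ φ≡φ′ (det-partialCharMat-cospectral φ≡φ′ φ-r≡φ′-r′ (dropFirst B)))
                 (cong₂ _*_ φ-r≡φ′-r′ (det-partialCharMat-cospectral φ≡φ′ φ-r≡φ′-r′ (bareFirst B))) ⟩
  charPoly P′ x * det (partialCharMat P′ r′ x (dropFirst B)) + charPoly (deleteMat P′ r′) x * det (partialCharMat P′ r′ x (bareFirst B))
    ≡⟨ sym (Peel.det-partialCharMat-peel P′ r′ x B) ⟩
  det (partialCharMat P′ r′ x B) ∎
  where open ≡-Reasoning

mainTheorem4 : ∀ {n k} (S : SignedGraph n) (G H : SimpleGraph (suc k))
    (u v : Fin (suc k)) → ¬ Isomorphic G H → CospectrallyRooted G u H v →
    Cospectral (rootedProductMat (mat S) (adjMat G) u)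
               (rootedProductMat (mat S) (adjMat H) v)
mainTheorem4 S G H u v _ (G≈H , G-u≈H-v) x = begin
  charPoly (rootedProductMat (mat S) (adjMat G) u) x       ≡⟨ charPoly-rootedProduct (mat S) (adjMat G) u x ⟩
  det (partialCharMat (adjMat G) u x (expandAll (mat S)))  ≡⟨ det-partialCharMat-cospectral {P = adjMat G} {adjMat H} {u} {v} (G≈H x) (G-u≈H-v x) (expandAll (mat S)) ⟩
  det (partialCharMat (adjMat H) v x (expandAll (mat S)))  ≡⟨ sym (charPoly-rootedProduct (mat S) (adjMat H) v x) ⟩
  charPoly (rootedProductMat (mat S) (adjMat H) v) x       ∎
  where open ≡-Reasoning
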